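{- Let $p$ be a prime, $n\in\mathbb{Z}^+$, $d\in[0,n]$ and $\ell=\ell_p(d)=\lceil\log_p(d+1)\rceil$. Over $\mathbb{F}_p$: (a) For any $E\subseteq[0,n]$ and $j\in E$ with $j+p^\ell\in[0,n]$, $\operatorname{Sym\text{ - }cl}_{n,d}(E)=\operatorname{Sym\text{ - }cl}_{n,d}((E\cup\{j+p^\ell\})\setminus\{j\})$. (b) For any $E\subseteq[0,n]$ and $j\in[0,n]$: $j\in\operatorname{Sym\text{ - }cl}_{n,d}(E)$ if and only if $j\oplus p^\ell\subseteq\operatorname{Sym\text{ - }cl}_{n,d}(E)$. (c) For any $E\subseteq[d,n-d]$ and $j\in E$ with $j+p^\ell\in[d,n-d]$, $\operatorname{Z\text{ - }cl}_{n,d}(E)=\operatorname{Z\text{ - }cl}_{n,d}((E\cup\{j+p^\ell\})\setminus\{j\})$. (d) For any $E\subseteq[d,n-d]$ and $j\in[d,n-d]$: $j\in\operatorname{Z\text{ - }cl}_{n,d}(E)$ if and only if $j\oplus p^\ell\subseteq\operatorname{Z\text{ - }cl}_{n,d}(E)$.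
   Context: For integers $a\le b$, $[a,b]$ denotes the set of integers between $a$ and $b$; $j\oplus p^\ell=\{t\in[0,n]:t\equiv j\pmod{p^\ell}\}$. Work over $\mathbb{F}_p$ with $\{0,1\}^n\subseteq\mathbb{F}_p^n$; $|x|$ is the Hamming weight, and for $E\subseteq[0,n]$, $\underline{E}=\{x\in\{0,1\}^n:|x|\in E\}$. $\operatorname{Z\text{ - }cl}_{n,d}(\underline{E})$ (resp. $\operatorname{Sym\text{ - }cl}_{n,d}(\underline{E})$) is the set of $y\in\{0,1\}^n$ at which every polynomial (resp. every symmetric polynomial, i.e. invariant under permuting variables) in $\mathbb{F}_p[X_1,\dots,X_n]$ of degree at most $d$ vanishing on $\underline{E}$ also vanishes. Both are symmetric sets, identified with their sets of Hamming weights, denoted $\operatorname{Z\text{ - }cl}_{n,d}(E),\operatorname{Sym\text{ - }cl}_{n,d}(E)\subseteq[0,n]$. -}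

module Defs where

open import Data.Nat using (ℕ; zero; suc; _+_; _*_; _∸_; _^_; _≤_; _<_; _%_; NonZero)
open import Data.Nat.Primality using (Prime)
open import Data.Bool using (Bool; true; false)
open import Data.Vec using (Vec; []; _∷_; lookup; tabulate)
open import Data.List using (List; [_]; map; concatMap; upTo)
open import Data.Nat.ListAction using (sum)
open import Data.Fin.Permutation using (Permutation′; _⟨$⟩ʳ_)
open import Data.Product using (Σ; ∃; _×_; _,_)
open import Data.Sum using (_⊎_)
open import Relation.Binary.PropositionalEquality using (_≡_; _≢_)
open import Relation.Nullary using (¬_)
open import Function.Bundles using (_⇔_)

bit : Bool → ℕ
bit true  = 1
bit false = 0

weight : ∀ {n} → Vec Bool n → ℕ
weight []       = 0
weight (b ∷ bs) = bit b + weight bs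

-- Exponent vectors (monomials X^e) of total degree ≤ d, each listed exactly once
monos : (n d : ℕ) → List (Vec ℕ n)
monos zero    d = [ [] ]
monos (suc n) d = concatMap (λ k → map (k ∷_) (monos n (d ∸ k))) (upTo (suc d))

monoVal : ∀ {n} → Vec Bool n → Vec ℕ n → ℕ
monoVal []       []       = 1
monoVal (b ∷ bs) (k ∷ ks) = (bit b ^ k) * monoVal bs ks

-- A polynomial in F_p[X_1..X_n] of degree ≤ d is given by a coefficient function
-- c : Vec ℕ n → ℕ, with c e read mod p, used only on exponent vectors e of total degree ≤ d.

evalP : (p n d : ℕ) → (Vec ℕ n → ℕ) → Vec Bool n → ℕ
evalP p n d c x = sum (map (λ e → c e * monoVal x e) (monos n d))

Vanishes : (p n d : ℕ) .{{_ : NonZero p}} → (Vec ℕ n → ℕ) → Vec Bool n → Set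
Vanishes p n d c x = evalP p n d c x % p ≡ 0

-- permuting the variables: X_i ↦ X_{σ i}, acting on exponent vectors
permVec : ∀ {n} → Permutation′ n → Vec ℕ n → Vec ℕ n
permVec σ e = tabulate (λ i → lookup e (σ ⟨$⟩ʳ i))

degree : ∀ {n} → Vec ℕ n → ℕ
degree []       = 0
degree (k ∷ ks) = k + degree ks

Symmetric : (p n d : ℕ) .{{_ : NonZero p}} → (Vec ℕ n → ℕ) → Set
Symmetric p n d c = ∀ (σ : Permutation′ n) (e : Vec ℕ n) → degree e ≤ d →
  c (permVec σ e) % p ≡ c e % p

WSet : Set₁
WSet = ℕ → Set

Under : ∀ {n} → WSet → Vec Bool n → Set
Under E x = E (weight x)

InZcl : (p n d : ℕ) .{{_ : NonZero p}} → WSet → Vec Bool n → Set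
InZcl p n d E y = ∀ (c : Vec ℕ n → ℕ) →
  (∀ x → Under E x → Vanishes p n d c x) → Vanishes p n d c y

InSymcl : (p n d : ℕ) .{{_ : NonZero p}} → WSet → Vec Bool n → Set
InSymcl p n d E y = ∀ (c : Vec ℕ n → ℕ) → Symmetric p n d c →
  (∀ x → Under E x → Vanishes p n d c x) → Vanishes p n d c y

Zcl : (p n d : ℕ) .{{_ : NonZero p}} → WSet → WSet
Zcl p n d E t = t ≤ n × (∀ (y : Vec Bool n) → weight y ≡ t → InZcl p n d E y)

Symcl : (p n d : ℕ) .{{_ : NonZero p}} → WSet → WSet
Symcl p n d E t = t ≤ n × (∀ (y : Vec Bool n) → weight y ≡ t → InSymcl p n d E y)

_⊆_ : WSet → WSet → Set
A ⊆ B = ∀ t → A t → B t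

_≐_ : WSet → WSet → Set
A ≐ B = ∀ t → (A t ⇔ B t)

Interval : ℕ → ℕ → WSet
Interval a b t = a ≤ t × t ≤ b

Shift : WSet → ℕ → ℕ → WSet
Shift E j k t = (E t ⊎ t ≡ k) × t ≢ j

ModEq : ℕ → ℕ → ℕ → Set
ModEq m a b = ∃ λ k → (a ≡ b + k * m) ⊎ (b ≡ a + k * m)

Coset : ℕ → ℕ → ℕ → WSet
Coset n m j t = t ≤ n × ModEq m t j

-- ℓ = ⌈log_p (d+1)⌉ : the least ℓ with d+1 ≤ p^ℓ
IsCeilLog : ℕ → ℕ → ℕ → Set
IsCeilLog p d ℓ = d < p ^ ℓ × (∀ k → d < p ^ k → ℓ ≤ k)

module Submission where

-- Write m = p ^ ℓ, so that d < m. For a point y and a set B of coordinates disjoint from it, the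
-- sum of a polynomial ∑ₑ cₑ Xᵉ of degree ≤ d over the points y ∪ S with S ⊆ B and |S| = k is
-- ∑ₑ cₑ · (the part of Xᵉ outside B, at y) · C(a, k − b), where b ≤ d is the number of variables
-- of Xᵉ in B and a + b = |B|. By Lucas' theorem these coefficients agree modulo p for two values
-- of k when |B| = m + d: for k = 0 and k = m, and for k = d and k = m + d. So a polynomial that
-- vanishes on the layer of weight w also vanishes on the layer of weight w + m if d ≤ w, and on
-- the layer of weight w − m if w ≤ n − d. A symmetric polynomial is constant on layers; take
-- |B| = m instead. The alternating sum over k of the sums above is 0, and for 0 < k < m the k-th
-- sum is a multiple of C(m, k) ≡ 0, so the layers w and w + m vanish together, for every w.
-- Iterating these shifts gives (b) and (d); for (a) and (c), replacing j by j + m in E does not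
-- change which polynomials vanish on E.

open import Defs
open import Data.Nat using (ℕ; _+_; _∸_; _^_; _≤_; _<_; NonZero)
open import Data.Nat.Primality using (Prime)
open import Data.Product using (_×_)
open import Function.Bundles using (_⇔_)

open import Data.Bool using (Bool; true; false; not; if_then_else_)
open import Data.Empty using (⊥-elim)
open import Data.Fin.Patterns using (0F; 1F)
open import Data.Fin.Permutation using (lift₀; transpose)
open import Data.List using (List; []; _∷_; [_]; _++_; map; concatMap; upTo; applyUpTo; length)
open import Data.List.Properties using (map-cong; map-++; map-∘; map-upTo; length-map; length-++)
open import Data.List.Relation.Unary.All as All using (All; []; _∷_)
open import Data.List.Relation.Unary.All.Properties using (concat⁺; map⁺; ++⁺; all-upTo)
open import Data.Nat using (zero; suc; pred; _*_; _%_; z≤n; s≤s; s≤s⁻¹)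
open import Data.Nat.Combinatorics using (_C_; nCk+nC[k+1]≡[n+1]C[k+1]; nC1≡n; nCn≡1; nCk≡nC[n∸k]; k>n⇒nCk≡0)
open import Data.Nat.Divisibility using (_∣_; divides; ∣-trans; m∣m*n; *-cancelˡ-∣; n∣m⇒m%n≡0)
open import Data.Nat.DivMod using (%-distribˡ-+; %-distribˡ-*; m*n%n≡0)
open import Data.Nat.ListAction using (sum)
open import Data.Nat.ListAction.Properties using (sum-++)
open import Data.Nat.Primality using (euclidsLemma)
open import Data.Nat.Properties
open import Algebra.Properties.CommutativeSemigroup +-commutativeSemigroup using (interchange)
open import Algebra.Properties.CommutativeSemigroup *-commutativeSemigroup using (x∙yz≈y∙xz)
open import Data.Product using (_,_; ∃; ∃₂; proj₁)
open import Data.Sum using (_⊎_; inj₁; inj₂)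
open import Data.Unit using (⊤; tt)
open import Data.Vec using (Vec; []; _∷_)
open import Data.Vec.Properties using (tabulate∘lookup)
open import Function using (_∘_)
open import Function.Bundles using (mk⇔; Equivalence)
import Function.Properties.Equivalence as ⇔
open import Relation.Binary.PropositionalEquality hiding ([_])
open import Relation.Nullary using (yes; no)

∑ : {A : Set} → List A → (A → ℕ) → ℕ
∑ L f = sum (map f L)

infix 5 ∑ ∑<
syntax ∑ L (λ x → e) = ∑[ x ∈ L ] e

∑< : ℕ → (ℕ → ℕ) → ℕ
∑< N f = sum (applyUpTo f N)

syntax ∑< N (λ k → e) = ∑[ k < N ] e

private variable
  A B : Set

∑-cong : ∀ (L : List A) {f g : A → ℕ} → (∀ x → f x ≡ g x) → ∑ L f ≡ ∑ L g
∑-cong L f≗g = cong sum (map-cong f≗g L)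

∑-++ : ∀ (L M : List A) (f : A → ℕ) → ∑ (L ++ M) f ≡ ∑ L f + ∑ M f
∑-++ L M f = trans (cong sum (map-++ f L M)) (sum-++ (map f L) (map f M))

∑-map : (g : A → B) (L : List A) (f : B → ℕ) → ∑ (map g L) f ≡ ∑[ x ∈ L ] f (g x)
∑-map g L f = cong sum (sym (map-∘ L))

∑-concatMap : (h : A → List B) (L : List A) (f : B → ℕ) →
              ∑ (concatMap h L) f ≡ ∑[ x ∈ L ] ∑ (h x) f
∑-concatMap h []      f = refl
∑-concatMap h (x ∷ L) f = trans (∑-++ (h x) (concatMap h L) f) (cong (∑ (h x) f +_) (∑-concatMap h L f))

∑-+ : ∀ (L : List A) (f g : A → ℕ) → ∑[ x ∈ L ] (f x + g x) ≡ ∑ L f + ∑ L g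
∑-+ []      f g = refl
∑-+ (x ∷ L) f g = trans (cong (f x + g x +_) (∑-+ L f g)) (interchange (f x) (g x) (∑ L f) (∑ L g))

∑-*ˡ : ∀ (L : List A) a (f : A → ℕ) → ∑[ x ∈ L ] a * f x ≡ a * ∑ L f
∑-*ˡ []      a f = sym (*-zeroʳ a)
∑-*ˡ (x ∷ L) a f = trans (cong (a * f x +_) (∑-*ˡ L a f)) (sym (*-distribˡ-+ a (f x) (∑ L f)))

∑-zero : ∀ (L : List A) → ∑[ x ∈ L ] 0 ≡ 0
∑-zero []      = refl
∑-zero (x ∷ L) = ∑-zero L

∑-const : ∀ (L : List A) a → ∑[ _ ∈ L ] a ≡ a * length L
∑-const []      a = sym (*-zeroʳ a)
∑-const (_ ∷ L) a = trans (cong (a +_) (∑-const L a)) (sym (*-suc a (length L)))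

∑-swap : (L : List A) (M : List B) (g : A → B → ℕ) →
         ∑[ x ∈ L ] ∑[ y ∈ M ] g x y ≡ ∑[ y ∈ M ] ∑[ x ∈ L ] g x y
∑-swap []      M g = sym (∑-zero M)
∑-swap (x ∷ L) M g = trans (cong (∑ M (g x) +_) (∑-swap L M g)) (sym (∑-+ M (g x) (λ y → ∑[ x′ ∈ L ] g x′ y)))

∑[upTo]≡∑< : ∀ N (f : ℕ → ℕ) → ∑[ k ∈ upTo N ] f k ≡ ∑[ k < N ] f k
∑[upTo]≡∑< N f = cong sum (map-upTo f N)

∑<-cong : ∀ N {f g : ℕ → ℕ} → (∀ k → f k ≡ g k) → ∑[ k < N ] f k ≡ ∑[ k < N ] g k
∑<-cong zero    f≗g = refl
∑<-cong (suc N) f≗g = cong₂ _+_ (f≗g 0) (∑<-cong N (f≗g ∘ suc))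

∑<-+ : ∀ N (f g : ℕ → ℕ) → ∑[ k < N ] (f k + g k) ≡ (∑[ k < N ] f k) + (∑[ k < N ] g k)
∑<-+ zero    f g = refl
∑<-+ (suc N) f g = trans (cong (f 0 + g 0 +_) (∑<-+ N (f ∘ suc) (g ∘ suc))) (interchange (f 0) (g 0) _ _)

module Congruence (p : ℕ) .{{_ : NonZero p}} where

  infix 4 _≈_
  _≈_ : ℕ → ℕ → Set
  a ≈ b = a % p ≡ b % p

  +-cong : ∀ {a a′ b b′} → a ≈ a′ → b ≈ b′ → a + b ≈ a′ + b′
  +-cong {a} {a′} {b} {b′} a≈a′ b≈b′ = begin
    (a + b) % p                  ≡⟨ %-distribˡ-+ a b p ⟩
    (a % p + b % p) % p          ≡⟨ cong₂ (λ u v → (u + v) % p) a≈a′ b≈b′ ⟩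
    (a′ % p + b′ % p) % p        ≡⟨ %-distribˡ-+ a′ b′ p ⟨
    (a′ + b′) % p                ∎
    where open ≡-Reasoning

  *-cong : ∀ {a a′ b b′} → a ≈ a′ → b ≈ b′ → a * b ≈ a′ * b′
  *-cong {a} {a′} {b} {b′} a≈a′ b≈b′ = begin
    (a * b) % p                  ≡⟨ %-distribˡ-* a b p ⟩
    (a % p * (b % p)) % p        ≡⟨ cong₂ (λ u v → (u * v) % p) a≈a′ b≈b′ ⟩
    (a′ % p * (b′ % p)) % p      ≡⟨ %-distribˡ-* a′ b′ p ⟨
    (a′ * b′) % p                ∎
    where open ≡-Reasoning

  0%p≡0 : 0 % p ≡ 0
  0%p≡0 = m*n%n≡0 0 p

  %≡0⇒≈0 : ∀ {a} → a % p ≡ 0 → a ≈ 0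
  %≡0⇒≈0 a%p≡0 = trans a%p≡0 (sym 0%p≡0)

  ≈0⇒%≡0 : ∀ {a} → a ≈ 0 → a % p ≡ 0
  ≈0⇒%≡0 a≈0 = trans a≈0 0%p≡0

  ∣⇒≈0 : ∀ {a} → p ∣ a → a ≈ 0
  ∣⇒≈0 {a} p∣a = %≡0⇒≈0 (n∣m⇒m%n≡0 a p p∣a)

  +≈0⇒≈0 : ∀ {a b} → a + b ≈ 0 → a ≈ 0 → b ≈ 0
  +≈0⇒≈0 {b = b} a+b≈0 a≈0 = trans (sym (+-cong a≈0 (refl {x = b % p}))) a+b≈0

  ∑-cong-≈ : ∀ {P : A → Set} {L : List A} {f g : A → ℕ} →
             All P L → (∀ x → P x → f x ≈ g x) → ∑ L f ≈ ∑ L g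
  ∑-cong-≈ []         f≈g = refl
  ∑-cong-≈ (px ∷ pxs) f≈g = +-cong (f≈g _ px) (∑-cong-≈ pxs f≈g)

  ∑-≈0 : ∀ {P : A → Set} {L : List A} {f : A → ℕ} →
         All P L → (∀ x → P x → f x ≈ 0) → ∑ L f ≈ 0
  ∑-≈0 {L = L} all f≈0 = trans (∑-cong-≈ all f≈0) (cong (_% p) (∑-zero L))

  ∑<-cong-≈ : ∀ N {f g : ℕ → ℕ} → (∀ k → k < N → f k ≈ g k) → ∑[ k < N ] f k ≈ ∑[ k < N ] g k
  ∑<-cong-≈ zero    f≈g = refl
  ∑<-cong-≈ (suc N) f≈g = +-cong (f≈g 0 (s≤s z≤n)) (∑<-cong-≈ N (λ k k<N → f≈g (suc k) (s≤s k<N)))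

-- Binomial coefficients

[1+k]*[1+n]C[1+k]≡[1+n]*nCk : ∀ n k → suc k * (suc n C suc k) ≡ suc n * (n C k)
[1+k]*[1+n]C[1+k]≡[1+n]*nCk n       zero    =
  trans (+-identityʳ _) (trans (nC1≡n (suc n)) (sym (*-identityʳ (suc n))))
[1+k]*[1+n]C[1+k]≡[1+n]*nCk zero    (suc k) =
  trans (cong (suc (suc k) *_) (k>n⇒nCk≡0 {1} {suc (suc k)} (s≤s (s≤s z≤n)))) (*-zeroʳ (suc (suc k)))
[1+k]*[1+n]C[1+k]≡[1+n]*nCk (suc n) (suc k) = begin
  suc (suc k) * (suc (suc n) C suc (suc k))           ≡⟨ cong (suc (suc k) *_) (nCk+nC[k+1]≡[n+1]C[k+1] (suc n) (suc k)) ⟨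
  suc (suc k) * (X + suc n C suc (suc k))             ≡⟨ *-distribˡ-+ (suc (suc k)) X _ ⟩
  X + suc k * X + suc (suc k) * (suc n C suc (suc k)) ≡⟨ cong₂ (λ u v → X + u + v) ([1+k]*[1+n]C[1+k]≡[1+n]*nCk n k)
                                                                               ([1+k]*[1+n]C[1+k]≡[1+n]*nCk n (suc k)) ⟩
  X + suc n * (n C k) + suc n * (n C suc k)           ≡⟨ +-assoc X _ _ ⟩
  X + (suc n * (n C k) + suc n * (n C suc k))         ≡⟨ cong (X +_) (*-distribˡ-+ (suc n) (n C k) _) ⟨
  X + suc n * (n C k + n C suc k)                     ≡⟨ cong (λ u → X + suc n * u) (nCk+nC[k+1]≡[n+1]C[k+1] n k) ⟩
  suc (suc n) * X                                     ∎
  where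
  open ≡-Reasoning
  X = suc n C suc k

module _ {p : ℕ} .{{_ : NonZero p}} (prime : Prime p) where

  open Congruence p

  p^ℓ∣k*x⇒p∣x : ∀ ℓ {k x} → 0 < k → k < p ^ ℓ → p ^ ℓ ∣ k * x → p ∣ x
  p^ℓ∣k*x⇒p∣x zero (s≤s z≤n) (s≤s ()) _
  p^ℓ∣k*x⇒p∣x (suc ℓ) {k} {x} 0<k k<p^ℓ p^ℓ∣kx with euclidsLemma k x prime (∣-trans (m∣m*n (p ^ ℓ)) p^ℓ∣kx)
  ... | inj₂ p∣x = p∣x
  ... | inj₁ (divides q refl) =
    p^ℓ∣k*x⇒p∣x ℓ 0<q q<p^ℓ (*-cancelˡ-∣ p (subst (p * p ^ ℓ ∣_) q*p*x≡p*[q*x] p^ℓ∣kx))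
    where
    q*p*x≡p*[q*x] : q * p * x ≡ p * (q * x)
    q*p*x≡p*[q*x] = trans (cong (_* x) (*-comm q p)) (*-assoc p q x)
    0<q : 0 < q
    0<q = n≢0⇒n>0 (λ { refl → n>0⇒n≢0 0<k refl })
    q<p^ℓ : q < p ^ ℓ
    q<p^ℓ = *-cancelʳ-< p q (p ^ ℓ) (subst (q * p <_) (*-comm p (p ^ ℓ)) k<p^ℓ)

  p∣p^ℓCk : ∀ ℓ {k} → 0 < k → k < p ^ ℓ → p ∣ p ^ ℓ C k
  p∣p^ℓCk ℓ {suc k} 0<k k<p^ℓ = p^ℓ∣k*x⇒p∣x ℓ 0<k k<p^ℓ
    (subst (λ m → m ∣ suc k * (m C suc k)) (suc-pred (p ^ ℓ) {{m^n≢0 p ℓ}}) [1+n]∣[1+k]*[1+n]C[1+k])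
    where
    n = pred (p ^ ℓ)
    [1+n]∣[1+k]*[1+n]C[1+k] : suc n ∣ suc k * (suc n C suc k)
    [1+n]∣[1+k]*[1+n]C[1+k] = divides (n C k) (trans ([1+k]*[1+n]C[1+k]≡[1+n]*nCk n k) (*-comm (suc n) _))

  [p^ℓ+r]Ck≈rCk : ∀ ℓ r {k} → k < p ^ ℓ → (p ^ ℓ + r) C k ≈ r C k
  [p^ℓ+r]Ck≈rCk ℓ zero    {zero}  _     = refl
  [p^ℓ+r]Ck≈rCk ℓ zero    {suc k} k<p^ℓ = trans (cong (λ m → (m C suc k) % p) (+-identityʳ (p ^ ℓ)))
                                                   (∣⇒≈0 (p∣p^ℓCk ℓ (s≤s z≤n) k<p^ℓ))
  [p^ℓ+r]Ck≈rCk ℓ (suc r) {zero}  _     = refl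
  [p^ℓ+r]Ck≈rCk ℓ (suc r) {suc k} k<p^ℓ = begin
    ((p ^ ℓ + suc r) C suc k) % p                     ≡⟨ cong (λ m → (m C suc k) % p) (+-suc (p ^ ℓ) r) ⟩
    (suc (p ^ ℓ + r) C suc k) % p                     ≡⟨ cong (_% p) (nCk+nC[k+1]≡[n+1]C[k+1] (p ^ ℓ + r) k) ⟨
    ((p ^ ℓ + r) C k + (p ^ ℓ + r) C suc k) % p       ≡⟨ +-cong ([p^ℓ+r]Ck≈rCk ℓ r (<-pred (m<n⇒m<1+n k<p^ℓ)))
                                                                ([p^ℓ+r]Ck≈rCk ℓ r k<p^ℓ) ⟩
    (r C k + r C suc k) % p                           ≡⟨ cong (_% p) (nCk+nC[k+1]≡[n+1]C[k+1] r k) ⟩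
    (suc r C suc k) % p                               ∎
    where open ≡-Reasoning

  [p^ℓ+r]C[p^ℓ]≈1 : ∀ ℓ {r} → r < p ^ ℓ → (p ^ ℓ + r) C p ^ ℓ ≈ 1
  [p^ℓ+r]C[p^ℓ]≈1 ℓ {r} r<p^ℓ = begin
    ((p ^ ℓ + r) C p ^ ℓ) % p                ≡⟨ cong (_% p) (nCk≡nC[n∸k] (m≤m+n (p ^ ℓ) r)) ⟩
    ((p ^ ℓ + r) C (p ^ ℓ + r ∸ p ^ ℓ)) % p  ≡⟨ cong (λ k → ((p ^ ℓ + r) C k) % p) (m+n∸m≡n (p ^ ℓ) r) ⟩
    ((p ^ ℓ + r) C r) % p                    ≡⟨ [p^ℓ+r]Ck≈rCk ℓ r r<p^ℓ ⟩
    (r C r) % p                              ≡⟨ cong (_% p) (nCn≡1 r) ⟩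
    1 % p                                    ∎
    where open ≡-Reasoning

∑-monos-suc : ∀ n d (f : Vec ℕ (suc n) → ℕ) →
              ∑[ e ∈ monos (suc n) d ] f e ≡ ∑[ k < suc d ] ∑[ e ∈ monos n (d ∸ k) ] f (k ∷ e)
∑-monos-suc n d f = begin
  ∑ (concatMap (λ k → map (k ∷_) (monos n (d ∸ k))) (upTo (suc d))) f
    ≡⟨ ∑-concatMap (λ k → map (k ∷_) (monos n (d ∸ k))) (upTo (suc d)) f ⟩
  ∑[ k ∈ upTo (suc d) ] ∑ (map (k ∷_) (monos n (d ∸ k))) f
    ≡⟨ ∑-cong (upTo (suc d)) (λ k → ∑-map (k ∷_) (monos n (d ∸ k)) f) ⟩
  ∑[ k ∈ upTo (suc d) ] ∑[ e ∈ monos n (d ∸ k) ] f (k ∷ e)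
    ≡⟨ ∑[upTo]≡∑< (suc d) _ ⟩
  ∑[ k < suc d ] ∑[ e ∈ monos n (d ∸ k) ] f (k ∷ e) ∎
  where open ≡-Reasoning

degree-∷-≤ : ∀ {n k d} {e : Vec ℕ n} → k ≤ d → degree e ≤ d ∸ k → degree (k ∷ e) ≤ d
degree-∷-≤ {k = k} {d} {e} k≤d e≤d∸k = subst (_≤ d) (+-comm (degree e) k) (m≤o∸n⇒m+n≤o (degree e) k≤d e≤d∸k)

monos-degree : ∀ n d → All (λ e → degree e ≤ d) (monos n d)
monos-degree zero    d = z≤n ∷ []
monos-degree (suc n) d = concat⁺ (map⁺ (All.map degree-k∷e (all-upTo (suc d))))
  where
  degree-k∷e : ∀ {k} → k < suc d → All (λ e → degree e ≤ d) (map (k ∷_) (monos n (d ∸ k)))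
  degree-k∷e {k} k<1+d = map⁺ (All.map (λ {e} → degree-∷-≤ {e = e} (s≤s⁻¹ k<1+d)) (monos-degree n (d ∸ k)))

triangle : ℕ → (ℕ → ℕ → ℕ) → ℕ
triangle d G = ∑[ k < suc d ] ∑[ k′ < suc (d ∸ k) ] G k k′

strictTriangle : ℕ → (ℕ → ℕ → ℕ) → ℕ
strictTriangle d G = ∑[ k < suc d ] ∑[ k′ < d ∸ k ] G k k′

triangle-splitColumn : ∀ d G →
  triangle d G ≡ (∑[ k < suc d ] G k 0) + strictTriangle d (λ k k′ → G k (suc k′))
triangle-splitColumn d G = ∑<-+ (suc d) (λ k → G k 0) (λ k → ∑[ k′ < d ∸ k ] G k (suc k′))

strictTriangle-suc : ∀ d G → strictTriangle (suc d) G ≡ triangle d G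
strictTriangle-suc zero    G = refl
strictTriangle-suc (suc d) G = cong ((∑[ k′ < suc (suc d) ] G 0 k′) +_) (strictTriangle-suc d (G ∘ suc))

triangle-transpose       : ∀ d G → triangle d G ≡ triangle d (λ k k′ → G k′ k)
strictTriangle-transpose : ∀ d G → strictTriangle d G ≡ strictTriangle d (λ k k′ → G k′ k)

strictTriangle-transpose zero    G = refl
strictTriangle-transpose (suc d) G =
  trans (strictTriangle-suc d G) (trans (triangle-transpose d G) (sym (strictTriangle-suc d (λ k k′ → G k′ k))))

triangle-transpose zero    G = refl
triangle-transpose (suc d) G = begin
  (G 0 0 + row) + triangle d (G ∘ suc)
    ≡⟨ cong ((G 0 0 + row) +_) (triangle-splitColumn d (G ∘ suc)) ⟩
  (G 0 0 + row) + (column + strictTriangle d inner)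
    ≡⟨ cong (λ t → (G 0 0 + row) + (column + t)) (strictTriangle-transpose d inner) ⟩
  (G 0 0 + row) + (column + strictTriangle d innerᵀ)
    ≡⟨ interchange (G 0 0) row column _ ⟩
  (G 0 0 + column) + (row + strictTriangle d innerᵀ)
    ≡⟨ cong ((G 0 0 + column) +_) (triangle-splitColumn d (λ k k′ → G k′ (suc k))) ⟨
  (G 0 0 + column) + triangle d (λ k k′ → G k′ (suc k)) ∎
  where
  open ≡-Reasoning
  row    = ∑[ k′ < suc d ] G 0 (suc k′)
  column = ∑[ k < suc d ] G (suc k) 0
  inner  = λ k k′ → G (suc k) (suc k′)
  innerᵀ = λ k k′ → G (suc k′) (suc k)

swap₀₁ : ∀ {n} → Vec ℕ (suc (suc n)) → Vec ℕ (suc (suc n))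
swap₀₁ (a ∷ b ∷ e) = b ∷ a ∷ e

∑-monos-triangle : ∀ n d (f : Vec ℕ (suc (suc n)) → ℕ) →
  ∑[ e ∈ monos (suc (suc n)) d ] f e ≡ triangle d (λ k k′ → ∑[ e ∈ monos n (d ∸ k ∸ k′) ] f (k ∷ k′ ∷ e))
∑-monos-triangle n d f =
  trans (∑-monos-suc (suc n) d f) (∑<-cong (suc d) (λ k → ∑-monos-suc n (d ∸ k) (λ e → f (k ∷ e))))

∑-monos-swap₀₁ : ∀ n d (f : Vec ℕ (suc (suc n)) → ℕ) →
  ∑[ e ∈ monos (suc (suc n)) d ] f e ≡ ∑[ e ∈ monos (suc (suc n)) d ] f (swap₀₁ e)
∑-monos-swap₀₁ n d f = begin
  ∑[ e ∈ monos (suc (suc n)) d ] f e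
    ≡⟨ ∑-monos-triangle n d f ⟩
  triangle d (λ k k′ → ∑[ e ∈ monos n (d ∸ k ∸ k′) ] f (k ∷ k′ ∷ e))
    ≡⟨ triangle-transpose d (λ k k′ → ∑[ e ∈ monos n (d ∸ k ∸ k′) ] f (k ∷ k′ ∷ e)) ⟩
  triangle d (λ k k′ → ∑[ e ∈ monos n (d ∸ k′ ∸ k) ] f (k′ ∷ k ∷ e))
    ≡⟨ ∑<-cong (suc d) (λ k → ∑<-cong (suc (d ∸ k)) (λ k′ →
         cong (λ r → ∑[ e ∈ monos n r ] f (k′ ∷ k ∷ e)) (∸-comm d k′ k))) ⟩
  triangle d (λ k k′ → ∑[ e ∈ monos n (d ∸ k ∸ k′) ] f (swap₀₁ (k ∷ k′ ∷ e)))
    ≡⟨ ∑-monos-triangle n d (f ∘ swap₀₁) ⟨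
  ∑[ e ∈ monos (suc (suc n)) d ] f (swap₀₁ e) ∎
  where
  open ≡-Reasoning
  ∸-comm : ∀ d a b → d ∸ a ∸ b ≡ d ∸ b ∸ a
  ∸-comm d a b = trans (∸-+-assoc d a b) (trans (cong (d ∸_) (+-comm a b)) (sym (∸-+-assoc d b a)))

weight≤length : ∀ {n} (x : Vec Bool n) → weight x ≤ n
weight≤length []          = z≤n
weight≤length (true ∷ x)  = s≤s (weight≤length x)
weight≤length (false ∷ x) = m≤n⇒m≤1+n (weight≤length x)

prefixOnes : (n w : ℕ) → Vec Bool n
prefixOnes zero    w       = []
prefixOnes (suc n) zero    = false ∷ prefixOnes n zero
prefixOnes (suc n) (suc w) = true ∷ prefixOnes n w

weight-prefixOnes : ∀ {n w} → w ≤ n → weight (prefixOnes n w) ≡ w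
weight-prefixOnes {zero}  z≤n       = refl
weight-prefixOnes {suc n} z≤n       = weight-prefixOnes {n} z≤n
weight-prefixOnes {suc n} (s≤s w≤n) = cong suc (weight-prefixOnes w≤n)

-- Symmetric polynomials are constant on the layers of the cube

module _ {p : ℕ} .{{_ : NonZero p}} where

  open Congruence p

  Symmetric-tail : ∀ {n d c} k a → k ≤ d → Symmetric p (suc n) d c → Symmetric p n (d ∸ k) (λ e → c (k ∷ e) * a)
  Symmetric-tail k a k≤d symmetric σ e e≤d∸k =
    *-cong (symmetric (lift₀ σ) (k ∷ e) (degree-∷-≤ {e = e} k≤d e≤d∸k)) refl

  Symmetric-swap₀₁ : ∀ {n d c} → Symmetric p (suc (suc n)) d c → ∀ e → degree e ≤ d → c (swap₀₁ e) ≈ c e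
  Symmetric-swap₀₁ {c = c} symmetric (a ∷ b ∷ e) e≤d =
    trans (cong (λ v → c (b ∷ a ∷ v) % p) (sym (tabulate∘lookup e))) (symmetric (transpose 0F 1F) (a ∷ b ∷ e) e≤d)

  evalP-∷ : ∀ {n d} c b (x : Vec Bool n) →
            evalP p (suc n) d c (b ∷ x) ≡ ∑[ k < suc d ] evalP p n (d ∸ k) (λ e → c (k ∷ e) * bit b ^ k) x
  evalP-∷ {n} {d} c b x = trans (∑-monos-suc n d (λ e → c e * monoVal (b ∷ x) e))
    (∑<-cong (suc d) (λ k → ∑-cong (monos n (d ∸ k)) (λ e → sym (*-assoc (c (k ∷ e)) (bit b ^ k) (monoVal x e)))))

  evalP-swap₀₁ : ∀ {n d c} → Symmetric p (suc (suc n)) d c → ∀ a b (x : Vec Bool n) →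
                 evalP p (suc (suc n)) d c (a ∷ b ∷ x) ≈ evalP p (suc (suc n)) d c (b ∷ a ∷ x)
  evalP-swap₀₁ {n} {d} {c} symmetric a b x =
    trans (cong (_% p) (∑-monos-swap₀₁ n d (λ e → c e * monoVal (a ∷ b ∷ x) e)))
          (∑-cong-≈ (monos-degree (suc (suc n)) d) term)
    where
    term : ∀ e → degree e ≤ d → c (swap₀₁ e) * monoVal (a ∷ b ∷ x) (swap₀₁ e) ≈ c e * monoVal (b ∷ a ∷ x) e
    term (k ∷ k′ ∷ e) e≤d = *-cong (Symmetric-swap₀₁ symmetric (k ∷ k′ ∷ e) e≤d)
                                   (cong (_% p) (x∙yz≈y∙xz (bit a ^ k′) (bit b ^ k) (monoVal x e)))

  evalP-layerConstant : ∀ n {d c} → Symmetric p n d c → ∀ (x x′ : Vec Bool n) →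
                        weight x ≡ weight x′ → evalP p n d c x ≈ evalP p n d c x′
  evalP-∷-cong : ∀ n {d c} → Symmetric p (suc n) d c → ∀ b (x x′ : Vec Bool n) →
                 weight x ≡ weight x′ → evalP p (suc n) d c (b ∷ x) ≈ evalP p (suc n) d c (b ∷ x′)
  evalP-true∷≈false∷ : ∀ n {d c} → Symmetric p (suc n) d c → ∀ (x x′ : Vec Bool n) →
                       suc (weight x) ≡ weight x′ → evalP p (suc n) d c (true ∷ x) ≈ evalP p (suc n) d c (false ∷ x′)

  evalP-∷-cong n {d} {c} symmetric b x x′ x~x′ = begin
    evalP p (suc n) d c (b ∷ x) % p
      ≡⟨ cong (_% p) (evalP-∷ c b x) ⟩
    (∑[ k < suc d ] evalP p n (d ∸ k) (λ e → c (k ∷ e) * bit b ^ k) x) % p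
      ≡⟨ ∑<-cong-≈ (suc d) {tailValue x} {tailValue x′} (λ k k<1+d →
           evalP-layerConstant n (Symmetric-tail k (bit b ^ k) (s≤s⁻¹ k<1+d) symmetric) x x′ x~x′) ⟩
    (∑[ k < suc d ] evalP p n (d ∸ k) (λ e → c (k ∷ e) * bit b ^ k) x′) % p
      ≡⟨ cong (_% p) (evalP-∷ c b x′) ⟨
    evalP p (suc n) d c (b ∷ x′) % p ∎
    where
    open ≡-Reasoning
    tailValue : Vec Bool n → ℕ → ℕ
    tailValue y k = evalP p n (d ∸ k) (λ e → c (k ∷ e) * bit b ^ k) y

  evalP-true∷≈false∷ zero    _ [] [] ()
  evalP-true∷≈false∷ (suc n) {d} {c} symmetric x x′ eq = begin
    evalP p (suc (suc n)) d c (true ∷ x) % p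
      ≡⟨ evalP-∷-cong (suc n) symmetric true x (false ∷ y) (sym (weight-prefixOnes w≤n)) ⟩
    evalP p (suc (suc n)) d c (true ∷ false ∷ y) % p
      ≡⟨ evalP-swap₀₁ symmetric true false y ⟩
    evalP p (suc (suc n)) d c (false ∷ true ∷ y) % p
      ≡⟨ evalP-∷-cong (suc n) symmetric false (true ∷ y) x′ (trans (cong suc (weight-prefixOnes w≤n)) eq) ⟩
    evalP p (suc (suc n)) d c (false ∷ x′) % p ∎
    where
    open ≡-Reasoning
    w≤n : weight x ≤ n
    w≤n = s≤s⁻¹ (subst (_≤ suc n) (sym eq) (weight≤length x′))
    y = prefixOnes n (weight x)

  evalP-layerConstant zero    _         []          []           _  = refl
  evalP-layerConstant (suc n) symmetric (true ∷ x)  (true ∷ x′)  eq = evalP-∷-cong n symmetric true x x′ (suc-injective eq)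
  evalP-layerConstant (suc n) symmetric (false ∷ x) (false ∷ x′) eq = evalP-∷-cong n symmetric false x x′ eq
  evalP-layerConstant (suc n) symmetric (true ∷ x)  (false ∷ x′) eq = evalP-true∷≈false∷ n symmetric x x′ eq
  evalP-layerConstant (suc n) symmetric (false ∷ x) (true ∷ x′)  eq = sym (evalP-true∷≈false∷ n symmetric x′ x (sym eq))

-- Sums over the points between y and y ∪ B

Disjoint : ∀ {n} → Vec Bool n → Vec Bool n → Set
Disjoint []      []          = ⊤
Disjoint (b ∷ y) (false ∷ B) = Disjoint y B
Disjoint (b ∷ y) (true ∷ B)  = b ≡ false × Disjoint y B

infixr 6 _∪_
_∪_ : ∀ {n} → Vec Bool n → Vec Bool n → Vec Bool n
[]      ∪ []          = []
(b ∷ y) ∪ (false ∷ B) = b ∷ y ∪ B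
(b ∷ y) ∪ (true ∷ B)  = true ∷ y ∪ B

weight-∪ : ∀ {n} (y B : Vec Bool n) → Disjoint y B → weight (y ∪ B) ≡ weight y + weight B
weight-∪ []      []          _            = refl
weight-∪ (b ∷ y) (false ∷ B) y#B          = trans (cong (bit b +_) (weight-∪ y B y#B)) (sym (+-assoc (bit b) _ _))
weight-∪ (_ ∷ y) (true ∷ B)  (refl , y#B) = trans (cong suc (weight-∪ y B y#B)) (sym (+-suc (weight y) _))

split : ∀ {n} (z : Vec Bool n) {s} → s ≤ weight z → ∃₂ λ y B → Disjoint y B × weight B ≡ s × y ∪ B ≡ z
split []          {zero}  _         = [] , [] , tt , refl , refl
split (false ∷ z) {s}     s≤z       with split z s≤z
... | y , B , y#B , refl , refl      = false ∷ y , false ∷ B , y#B , refl , refl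
split (true ∷ z)  {zero}  _         with split z {zero} z≤n
... | y , B , y#B , B≡0 , refl       = true ∷ y , false ∷ B , y#B , B≡0 , refl
split (true ∷ z)  {suc s} (s≤s s≤z) with split z s≤z
... | y , B , y#B , refl , refl      = false ∷ y , true ∷ B , (refl , y#B) , refl , refl

extend : ∀ {n} (y : Vec Bool n) {s} → s + weight y ≤ n → ∃ λ B → Disjoint y B × weight B ≡ s
extend []          {zero}  _   = [] , tt , refl
extend (true ∷ y)  {s}     s+y≤n with extend y {s} (s≤s⁻¹ (≤-trans (≤-reflexive (sym (+-suc s (weight y)))) s+y≤n))
... | B , y#B , refl              = false ∷ B , y#B , refl
extend (false ∷ y) {zero}  _   with extend y {zero} (weight≤length y)
... | B , y#B , B≡0               = false ∷ B , y#B , B≡0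
extend (false ∷ y) {suc s} (s≤s s+y≤n) with extend y s+y≤n
... | B , y#B , refl              = true ∷ B , (refl , y#B) , refl

-- The points y ∪ S for the k-element subsets S of B.
extensions : ∀ {n} → Vec Bool n → Vec Bool n → ℕ → List (Vec Bool n)
extensions []      []          zero    = [ [] ]
extensions []      []          (suc k) = []
extensions (b ∷ y) (false ∷ B) k       = map (b ∷_) (extensions y B k)
extensions (b ∷ y) (true ∷ B)  zero    = map (b ∷_) (extensions y B zero)
extensions (b ∷ y) (true ∷ B)  (suc k) = map (b ∷_) (extensions y B (suc k)) ++ map (true ∷_) (extensions y B k)

extensions-weight : ∀ {n} (y B : Vec Bool n) k → Disjoint y B →
                    All (λ x → weight x ≡ weight y + k) (extensions y B k)
extensions-weight []      []          zero    _            = refl ∷ []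
extensions-weight []      []          (suc k) _            = []
extensions-weight (b ∷ y) (false ∷ B) k       y#B          =
  map⁺ (All.map (λ x≡y+k → trans (cong (bit b +_) x≡y+k) (sym (+-assoc (bit b) _ k))) (extensions-weight y B k y#B))
extensions-weight (_ ∷ y) (true ∷ B)  zero    (refl , y#B) = map⁺ (extensions-weight y B zero y#B)
extensions-weight (_ ∷ y) (true ∷ B)  (suc k) (refl , y#B) = ++⁺
  (map⁺ (extensions-weight y B (suc k) y#B))
  (map⁺ (All.map (λ x≡y+k → trans (cong suc x≡y+k) (sym (+-suc (weight y) k))) (extensions-weight y B k y#B)))

length-extensions : ∀ {n} (y B : Vec Bool n) k → length (extensions y B k) ≡ weight B C k
length-extensions []      []          zero    = refl
length-extensions []      []          (suc k) = refl
length-extensions (b ∷ y) (false ∷ B) k       = trans (length-map (b ∷_) (extensions y B k)) (length-extensions y B k)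
length-extensions (b ∷ y) (true ∷ B)  zero    = trans (length-map (b ∷_) (extensions y B zero)) (length-extensions y B zero)
length-extensions (b ∷ y) (true ∷ B)  (suc k) = begin
  length (map (b ∷_) (extensions y B (suc k)) ++ map (true ∷_) (extensions y B k))
    ≡⟨ length-++ (map (b ∷_) (extensions y B (suc k))) ⟩
  length (map (b ∷_) (extensions y B (suc k))) + length (map (true ∷_) (extensions y B k))
    ≡⟨ cong₂ _+_ (length-map (b ∷_) (extensions y B (suc k))) (length-map (true ∷_) (extensions y B k)) ⟩
  length (extensions y B (suc k)) + length (extensions y B k)
    ≡⟨ cong₂ _+_ (length-extensions y B (suc k)) (length-extensions y B k) ⟩
  weight B C suc k + weight B C k
    ≡⟨ +-comm (weight B C suc k) _ ⟩
  weight B C k + weight B C suc k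
    ≡⟨ nCk+nC[k+1]≡[n+1]C[k+1] (weight B) k ⟩
  suc (weight B) C suc k ∎
  where open ≡-Reasoning

extensions-zero : ∀ {n} (y B : Vec Bool n) → extensions y B 0 ≡ [ y ]
extensions-zero []      []          = refl
extensions-zero (b ∷ y) (false ∷ B) = cong (map (b ∷_)) (extensions-zero y B)
extensions-zero (b ∷ y) (true ∷ B)  = cong (map (b ∷_)) (extensions-zero y B)

extensions-empty : ∀ {n} (y B : Vec Bool n) {k} → weight B < k → extensions y B k ≡ []
extensions-empty []      []          {suc k} _         = refl
extensions-empty (b ∷ y) (false ∷ B) B<k               = cong (map (b ∷_)) (extensions-empty y B B<k)
extensions-empty (b ∷ y) (true ∷ B)  {suc k} (s≤s B<k) =
  cong₂ _++_ (cong (map (b ∷_)) (extensions-empty y B (m<n⇒m<1+n B<k))) (cong (map (true ∷_)) (extensions-empty y B B<k))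

extensions-full : ∀ {n} (y B : Vec Bool n) → extensions y B (weight B) ≡ [ y ∪ B ]
extensions-full []      []          = refl
extensions-full (b ∷ y) (false ∷ B) = cong (map (b ∷_)) (extensions-full y B)
extensions-full (b ∷ y) (true ∷ B)  =
  cong₂ _++_ (cong (map (b ∷_)) (extensions-empty y B ≤-refl)) (cong (map (true ∷_)) (extensions-full y B))

∑-extensions-zero : ∀ {n} (y B : Vec Bool n) (f : Vec Bool n → ℕ) → ∑[ x ∈ extensions y B 0 ] f x ≡ f y
∑-extensions-zero y B f = trans (cong (λ L → ∑ L f) (extensions-zero y B)) (+-identityʳ (f y))

∑-extensions-full : ∀ {n} (y B : Vec Bool n) (f : Vec Bool n → ℕ) →
                    ∑[ x ∈ extensions y B (weight B) ] f x ≡ f (y ∪ B)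
∑-extensions-full y B f = trans (cong (λ L → ∑ L f) (extensions-full y B)) (+-identityʳ (f (y ∪ B)))

-- supersetCount a b k = a C (k ∸ b) if b ≤ k, and 0 otherwise: the number of k-subsets of
-- an (a + b)-set that contain a fixed b-subset.
supersetCount : ℕ → ℕ → ℕ → ℕ
supersetCount a zero    k       = a C k
supersetCount a (suc b) zero    = 0
supersetCount a (suc b) (suc k) = supersetCount a b k

supersetCount-full : ∀ a b → supersetCount a b (b + a) ≡ 1
supersetCount-full a zero    = nCn≡1 a
supersetCount-full a (suc b) = supersetCount-full a b

supersetCount-zero : ∀ a b → supersetCount (suc a) b 0 ≡ supersetCount a b 0
supersetCount-zero a zero    = refl
supersetCount-zero a (suc b) = refl

supersetCount-pascal : ∀ a b k → supersetCount (suc a) b (suc k) ≡ supersetCount a b (suc k) + supersetCount a b k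
supersetCount-pascal a zero    k       = trans (sym (nCk+nC[k+1]≡[n+1]C[k+1] a k)) (+-comm (a C k) _)
supersetCount-pascal a (suc b) zero    = trans (supersetCount-zero a b) (sym (+-identityʳ _))
supersetCount-pascal a (suc b) (suc k) = supersetCount-pascal a b k

supersetCount-≥ : ∀ a b {k} → b ≤ k → supersetCount a b k ≡ a C (k ∸ b)
supersetCount-≥ a zero    _         = refl
supersetCount-≥ a (suc b) (s≤s b≤k) = supersetCount-≥ a b b≤k

supersetCount-> : ∀ a b {k} → a + b < k → supersetCount a b k ≡ 0
supersetCount-> a zero {k} a+0<k = k>n⇒nCk≡0 (subst (_< k) (+-identityʳ a) a+0<k)
supersetCount-> a (suc b) {suc k} a+b<k = supersetCount-> a b (s≤s⁻¹ (subst (_< suc k) (+-suc a b) a+b<k))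

zerosIn supportIn : ∀ {n} → Vec Bool n → Vec ℕ n → ℕ
zerosIn []          []          = 0
zerosIn (false ∷ B) (_ ∷ e)     = zerosIn B e
zerosIn (true ∷ B)  (zero ∷ e)  = suc (zerosIn B e)
zerosIn (true ∷ B)  (suc _ ∷ e) = zerosIn B e
supportIn []          []          = 0
supportIn (false ∷ B) (_ ∷ e)     = supportIn B e
supportIn (true ∷ B)  (zero ∷ e)  = supportIn B e
supportIn (true ∷ B)  (suc _ ∷ e) = suc (supportIn B e)

zerosIn+supportIn : ∀ {n} (B : Vec Bool n) e → zerosIn B e + supportIn B e ≡ weight B
zerosIn+supportIn []          []          = refl
zerosIn+supportIn (false ∷ B) (_ ∷ e)     = zerosIn+supportIn B e
zerosIn+supportIn (true ∷ B)  (zero ∷ e)  = cong suc (zerosIn+supportIn B e)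
zerosIn+supportIn (true ∷ B)  (suc _ ∷ e) = trans (+-suc (zerosIn B e) _) (cong suc (zerosIn+supportIn B e))

supportIn≤degree : ∀ {n} (B : Vec Bool n) e → supportIn B e ≤ degree e
supportIn≤degree []          []          = z≤n
supportIn≤degree (false ∷ B) (k ∷ e)     = ≤-trans (supportIn≤degree B e) (m≤n+m (degree e) k)
supportIn≤degree (true ∷ B)  (zero ∷ e)  = supportIn≤degree B e
supportIn≤degree (true ∷ B)  (suc k ∷ e) = s≤s (≤-trans (supportIn≤degree B e) (m≤n+m (degree e) k))

monoValOutside : ∀ {n} → Vec Bool n → Vec Bool n → Vec ℕ n → ℕ
monoValOutside []      []          []      = 1
monoValOutside (b ∷ y) (false ∷ B) (k ∷ e) = bit b ^ k * monoValOutside y B e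
monoValOutside (b ∷ y) (true ∷ B)  (k ∷ e) = monoValOutside y B e

∑-monoVal-map-∷ : ∀ {n} b k (e : Vec ℕ n) (L : List (Vec Bool n)) →
                  ∑[ x ∈ map (b ∷_) L ] monoVal x (k ∷ e) ≡ bit b ^ k * (∑[ x ∈ L ] monoVal x e)
∑-monoVal-map-∷ b k e L = trans (∑-map (b ∷_) L (λ x → monoVal x (k ∷ e))) (∑-*ˡ L (bit b ^ k) (λ x → monoVal x e))

∑-monoVal-branch : ∀ {n} j (e : Vec ℕ n) (L M : List (Vec Bool n)) →
  ∑[ x ∈ map (false ∷_) L ++ map (true ∷_) M ] monoVal x (j ∷ e)
    ≡ 0 ^ j * (∑[ x ∈ L ] monoVal x e) + 1 ^ j * (∑[ x ∈ M ] monoVal x e)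
∑-monoVal-branch j e L M = trans (∑-++ (map (false ∷_) L) (map (true ∷_) M) (λ x → monoVal x (j ∷ e)))
                                 (cong₂ _+_ (∑-monoVal-map-∷ false j e L) (∑-monoVal-map-∷ true j e M))

∑-monoVal-extensions : ∀ {n} (y B : Vec Bool n) e k → Disjoint y B →
  ∑[ x ∈ extensions y B k ] monoVal x e ≡ monoValOutside y B e * supersetCount (zerosIn B e) (supportIn B e) k
∑-monoVal-extensions []      []          []          zero    _   = refl
∑-monoVal-extensions []      []          []          (suc k) _   = refl
∑-monoVal-extensions (b ∷ y) (false ∷ B) (k₀ ∷ e)    k       y#B =
  trans (∑-monoVal-map-∷ b k₀ e (extensions y B k))
        (trans (cong (bit b ^ k₀ *_) (∑-monoVal-extensions y B e k y#B)) (sym (*-assoc (bit b ^ k₀) _ _)))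
∑-monoVal-extensions (_ ∷ y) (true ∷ B)  (zero ∷ e)  zero    (refl , y#B) =
  trans (∑-monoVal-map-∷ false 0 e (extensions y B 0))
        (trans (+-identityʳ _)
        (trans (∑-monoVal-extensions y B e 0 y#B)
               (cong (monoValOutside y B e *_) (sym (supersetCount-zero (zerosIn B e) (supportIn B e))))))
∑-monoVal-extensions (_ ∷ y) (true ∷ B)  (suc j ∷ e) zero    (refl , y#B) =
  trans (∑-monoVal-map-∷ false (suc j) e (extensions y B 0)) (sym (*-zeroʳ (monoValOutside y B e)))
∑-monoVal-extensions (_ ∷ y) (true ∷ B)  (zero ∷ e)  (suc k) (refl , y#B) = begin
  ∑[ x ∈ map (false ∷_) (extensions y B (suc k)) ++ map (true ∷_) (extensions y B k) ] monoVal x (0 ∷ e)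
    ≡⟨ ∑-monoVal-branch 0 e (extensions y B (suc k)) (extensions y B k) ⟩
  1 * (∑[ x ∈ extensions y B (suc k) ] monoVal x e) + 1 * (∑[ x ∈ extensions y B k ] monoVal x e)
    ≡⟨ cong₂ (λ u v → 1 * u + 1 * v) (∑-monoVal-extensions y B e (suc k) y#B) (∑-monoVal-extensions y B e k y#B) ⟩
  1 * (out * supersetCount a b (suc k)) + 1 * (out * supersetCount a b k)
    ≡⟨ cong₂ _+_ (*-identityˡ (out * supersetCount a b (suc k))) (*-identityˡ (out * supersetCount a b k)) ⟩
  out * supersetCount a b (suc k) + out * supersetCount a b k
    ≡⟨ *-distribˡ-+ out _ _ ⟨
  out * (supersetCount a b (suc k) + supersetCount a b k)
    ≡⟨ cong (out *_) (supersetCount-pascal a b k) ⟨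
  out * supersetCount (suc a) b (suc k) ∎
  where
  open ≡-Reasoning
  out = monoValOutside y B e
  a = zerosIn B e
  b = supportIn B e
∑-monoVal-extensions (_ ∷ y) (true ∷ B)  (suc j ∷ e) (suc k) (refl , y#B) = begin
  ∑[ x ∈ map (false ∷_) (extensions y B (suc k)) ++ map (true ∷_) (extensions y B k) ] monoVal x (suc j ∷ e)
    ≡⟨ ∑-monoVal-branch (suc j) e (extensions y B (suc k)) (extensions y B k) ⟩
  1 ^ suc j * (∑[ x ∈ extensions y B k ] monoVal x e)
    ≡⟨ cong (_* (∑[ x ∈ extensions y B k ] monoVal x e)) (^-zeroˡ (suc j)) ⟩
  1 * (∑[ x ∈ extensions y B k ] monoVal x e)
    ≡⟨ *-identityˡ _ ⟩
  ∑[ x ∈ extensions y B k ] monoVal x e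
    ≡⟨ ∑-monoVal-extensions y B e k y#B ⟩
  monoValOutside y B e * supersetCount (zerosIn B e) (supportIn B e) k ∎
  where open ≡-Reasoning

∑-evalP : ∀ {p n d} c (L : List (Vec Bool n)) →
          ∑[ x ∈ L ] evalP p n d c x ≡ ∑[ e ∈ monos n d ] c e * (∑[ x ∈ L ] monoVal x e)
∑-evalP {n = n} {d} c L = trans (∑-swap L (monos n d) (λ x e → c e * monoVal x e))
                                (∑-cong (monos n d) (λ e → ∑-*ˡ L (c e) (λ x → monoVal x e)))

∑-evalP-extensions : ∀ {p n d} c (y B : Vec Bool n) k → Disjoint y B →
  ∑[ x ∈ extensions y B k ] evalP p n d c x
    ≡ ∑[ e ∈ monos n d ] c e * monoValOutside y B e * supersetCount (zerosIn B e) (supportIn B e) k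
∑-evalP-extensions {p} {n} {d} c y B k y#B = trans (∑-evalP {p} c (extensions y B k))
  (∑-cong (monos n d) (λ e → trans (cong (c e *_) (∑-monoVal-extensions y B e k y#B)) (sym (*-assoc (c e) _ _))))

-- Alternating sums

-- paritySum q K f is the sum of the f k, k < K, with k even if q = true and odd if q = false.
paritySum : Bool → ℕ → (ℕ → ℕ) → ℕ
paritySum q zero    f = 0
paritySum q (suc K) f = (if q then f 0 else 0) + paritySum (not q) K (f ∘ suc)

paritySum-cong : ∀ q K {f g : ℕ → ℕ} → (∀ k → f k ≡ g k) → paritySum q K f ≡ paritySum q K g
paritySum-cong q zero    f≗g = refl
paritySum-cong q (suc K) f≗g = cong₂ _+_ (cong (λ v → if q then v else 0) (f≗g 0)) (paritySum-cong (not q) K (f≗g ∘ suc))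

paritySum-+ : ∀ q K (f g : ℕ → ℕ) → paritySum q K (λ k → f k + g k) ≡ paritySum q K f + paritySum q K g
paritySum-+ q     zero    f g = refl
paritySum-+ true  (suc K) f g =
  trans (cong (f 0 + g 0 +_) (paritySum-+ false K (f ∘ suc) (g ∘ suc))) (interchange (f 0) (g 0) _ _)
paritySum-+ false (suc K) f g = paritySum-+ true K (f ∘ suc) (g ∘ suc)

paritySum-∑ : ∀ q K (L : List A) (g : A → ℕ) (h : A → ℕ → ℕ) →
              paritySum q K (λ k → ∑[ e ∈ L ] g e * h e k) ≡ ∑[ e ∈ L ] g e * paritySum q K (h e)
paritySum-∑ q zero L g h = sym (trans (∑-cong L (λ e → *-zeroʳ (g e))) (∑-zero L))
paritySum-∑ q (suc K) L g h = begin
  (if q then ∑[ e ∈ L ] g e * h e 0 else 0) + paritySum (not q) K (λ k → ∑[ e ∈ L ] g e * h e (suc k))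
    ≡⟨ cong₂ _+_ (if-∑ q) (paritySum-∑ (not q) K L g (λ e → h e ∘ suc)) ⟩
  (∑[ e ∈ L ] g e * (if q then h e 0 else 0)) + (∑[ e ∈ L ] g e * paritySum (not q) K (h e ∘ suc))
    ≡⟨ ∑-+ L _ _ ⟨
  ∑[ e ∈ L ] (g e * (if q then h e 0 else 0) + g e * paritySum (not q) K (h e ∘ suc))
    ≡⟨ ∑-cong L (λ e → *-distribˡ-+ (g e) _ _) ⟨
  ∑[ e ∈ L ] g e * paritySum q (suc K) (h e) ∎
  where
  open ≡-Reasoning
  if-∑ : ∀ q → (if q then ∑[ e ∈ L ] g e * h e 0 else 0) ≡ ∑[ e ∈ L ] g e * (if q then h e 0 else 0)
  if-∑ true  = refl
  if-∑ false = sym (trans (∑-cong L (λ e → *-zeroʳ (g e))) (∑-zero L))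

paritySum-suc : ∀ q K {f : ℕ → ℕ} → f K ≡ 0 → paritySum q (suc K) f ≡ paritySum q K f
paritySum-suc true  zero    f0≡0 = cong (_+ 0) f0≡0
paritySum-suc false zero    _    = refl
paritySum-suc q     (suc K) fK≡0 = cong ((if q then _ else 0) +_) (paritySum-suc (not q) K fK≡0)

paritySum-supersetCount-pascal : ∀ q K a b → a + b < K →
  paritySum q (suc K) (supersetCount (suc a) b)
    ≡ paritySum q (suc K) (supersetCount a b) + paritySum (not q) (suc K) (supersetCount a b)
paritySum-supersetCount-pascal q K a b a+b<K = begin
  (if q then N₊ 0 else 0) + paritySum (not q) K (λ k → N₊ (suc k))
    ≡⟨ cong₂ _+_ (cong (λ v → if q then v else 0) (supersetCount-zero a b))
                 (paritySum-cong (not q) K (λ k → supersetCount-pascal a b k)) ⟩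
  (if q then N 0 else 0) + paritySum (not q) K (λ k → N (suc k) + N k)
    ≡⟨ cong ((if q then N 0 else 0) +_) (paritySum-+ (not q) K (N ∘ suc) N) ⟩
  (if q then N 0 else 0) + (paritySum (not q) K (N ∘ suc) + paritySum (not q) K N)
    ≡⟨ +-assoc (if q then N 0 else 0) _ _ ⟨
  paritySum q (suc K) N + paritySum (not q) K N
    ≡⟨ cong (paritySum q (suc K) N +_) (paritySum-suc (not q) K (supersetCount-> a b a+b<K)) ⟨
  paritySum q (suc K) N + paritySum (not q) (suc K) N ∎
  where
  open ≡-Reasoning
  N₊ = supersetCount (suc a) b
  N  = supersetCount a b

paritySum-supersetCount-balanced : ∀ K a b → 1 ≤ a → a + b < K →
  paritySum true K (supersetCount a b) ≡ paritySum false K (supersetCount a b)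
paritySum-supersetCount-balanced (suc K) (suc a) b _ (s≤s a+b<K) = begin
  paritySum true  (suc K) (supersetCount (suc a) b)          ≡⟨ paritySum-supersetCount-pascal true K a b a+b<K ⟩
  paritySum true  (suc K) N + paritySum false (suc K) N      ≡⟨ +-comm (paritySum true (suc K) N) _ ⟩
  paritySum false (suc K) N + paritySum true (suc K) N       ≡⟨ paritySum-supersetCount-pascal false K a b a+b<K ⟨
  paritySum false (suc K) (supersetCount (suc a) b)          ∎
  where
  open ≡-Reasoning
  N = supersetCount a b

module _ {p : ℕ} .{{_ : NonZero p}} where

  open Congruence p

  ∑-evalP-extensions-≈ : ∀ {n d} c (y B : Vec Bool n) {k k′} → Disjoint y B →
    (∀ a b → a + b ≡ weight B → b ≤ d → supersetCount a b k ≈ supersetCount a b k′) →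
    ∑[ x ∈ extensions y B k ] evalP p n d c x ≈ ∑[ x ∈ extensions y B k′ ] evalP p n d c x
  ∑-evalP-extensions-≈ {n} {d} c y B {k} {k′} y#B N≈N = begin
    (∑[ x ∈ extensions y B k ] evalP p n d c x) % p
      ≡⟨ cong (_% p) (∑-evalP-extensions {p} c y B k y#B) ⟩
    (∑[ e ∈ monos n d ] c e * monoValOutside y B e * supersetCount (zerosIn B e) (supportIn B e) k) % p
      ≡⟨ ∑-cong-≈ (monos-degree n d) (λ e e≤d → *-cong {c e * monoValOutside y B e} refl
           (N≈N (zerosIn B e) (supportIn B e) (zerosIn+supportIn B e) (≤-trans (supportIn≤degree B e) e≤d))) ⟩
    (∑[ e ∈ monos n d ] c e * monoValOutside y B e * supersetCount (zerosIn B e) (supportIn B e) k′) % p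
      ≡⟨ cong (_% p) (∑-evalP-extensions {p} c y B k′ y#B) ⟨
    (∑[ x ∈ extensions y B k′ ] evalP p n d c x) % p ∎
    where open ≡-Reasoning

  ∑-evalP-extensions-alternating : ∀ {n d} c (y B : Vec Bool n) → Disjoint y B → d < weight B →
    paritySum true (suc (weight B)) (λ k → ∑[ x ∈ extensions y B k ] evalP p n d c x)
      ≈ paritySum false (suc (weight B)) (λ k → ∑[ x ∈ extensions y B k ] evalP p n d c x)
  ∑-evalP-extensions-alternating {n} {d} c y B y#B d<B =
    trans (cong (_% p) (paritySum-expand true))
          (trans (∑-cong-≈ (monos-degree n d) term) (cong (_% p) (sym (paritySum-expand false))))
    where
    N : Vec ℕ n → ℕ → ℕ
    N e = supersetCount (zerosIn B e) (supportIn B e)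

    paritySum-expand : ∀ q → paritySum q (suc (weight B)) (λ k → ∑[ x ∈ extensions y B k ] evalP p n d c x)
                               ≡ ∑[ e ∈ monos n d ] c e * monoValOutside y B e * paritySum q (suc (weight B)) (N e)
    paritySum-expand q = trans (paritySum-cong q (suc (weight B)) (λ k → ∑-evalP-extensions {p} {n} {d} c y B k y#B))
                               (paritySum-∑ q (suc (weight B)) (monos n d) (λ e → c e * monoValOutside y B e) N)

    0<a : ∀ {a b} → a + b ≡ weight B → b < weight B → 0 < a
    0<a {zero}  refl b<b = ⊥-elim (<-irrefl refl b<b)
    0<a {suc a} _    _   = s≤s z≤n

    term : ∀ e → degree e ≤ d → c e * monoValOutside y B e * paritySum true  (suc (weight B)) (N e)
                              ≈ c e * monoValOutside y B e * paritySum false (suc (weight B)) (N e)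
    term e e≤d = cong (λ v → (c e * monoValOutside y B e * v) % p)
      (paritySum-supersetCount-balanced (suc (weight B)) (zerosIn B e) (supportIn B e)
        (0<a (zerosIn+supportIn B e) (≤-<-trans (≤-trans (supportIn≤degree B e) e≤d) d<B))
        (s≤s (≤-reflexive (zerosIn+supportIn B e))))

  ∑-evalP-layer≈0 : ∀ {n d c} → Symmetric p n d c → ∀ (L : List (Vec Bool n)) {w} →
    All (λ x → weight x ≡ w) L → p ∣ length L → ∑[ x ∈ L ] evalP p n d c x ≈ 0
  ∑-evalP-layer≈0 symmetric []      _                  _      = refl
  ∑-evalP-layer≈0 {n} {d} {c} symmetric (x ∷ L) all@(x≡w ∷ _) p∣len = begin
    (∑[ x′ ∈ x ∷ L ] evalP p n d c x′) % p
      ≡⟨ ∑-cong-≈ all (λ x′ x′≡w → evalP-layerConstant n symmetric x′ x (trans x′≡w (sym x≡w))) ⟩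
    (∑[ _ ∈ x ∷ L ] evalP p n d c x) % p       ≡⟨ cong (_% p) (∑-const (x ∷ L) (evalP p n d c x)) ⟩
    (evalP p n d c x * length (x ∷ L)) % p      ≡⟨ *-cong {evalP p n d c x} refl (∣⇒≈0 p∣len) ⟩
    (evalP p n d c x * 0) % p                   ≡⟨ cong (_% p) (*-zeroʳ (evalP p n d c x)) ⟩
    0 % p                                       ∎
    where open ≡-Reasoning

  paritySum-tail : ∀ q K {G : ℕ → ℕ} → G 0 ≈ 0 → paritySum q (suc K) G ≈ paritySum (not q) K (G ∘ suc)
  paritySum-tail true  K G0≈0 = +-cong G0≈0 refl
  paritySum-tail false K _    = refl

  paritySum-lastOnly : ∀ q M {G : ℕ → ℕ} → (∀ k → k < M → G k ≈ 0) →
    (paritySum q (suc M) G ≈ 0 × paritySum (not q) (suc M) G ≈ G M)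
    ⊎ (paritySum q (suc M) G ≈ G M × paritySum (not q) (suc M) G ≈ 0)
  paritySum-lastOnly true  zero    _ = inj₂ (cong (_% p) (+-identityʳ _) , refl)
  paritySum-lastOnly false zero    _ = inj₁ (refl , cong (_% p) (+-identityʳ _))
  paritySum-lastOnly true  (suc M) {G} G≈0 with paritySum-lastOnly false M {G ∘ suc} (λ k k<M → G≈0 (suc k) (s≤s k<M))
  ... | inj₁ (ps≈0 , ps≈G) = inj₁ (trans (paritySum-tail true (suc M) {G} (G≈0 0 (s≤s z≤n))) ps≈0 , ps≈G)
  ... | inj₂ (ps≈G , ps≈0) = inj₂ (trans (paritySum-tail true (suc M) {G} (G≈0 0 (s≤s z≤n))) ps≈G , ps≈0)
  paritySum-lastOnly false (suc M) {G} G≈0 with paritySum-lastOnly true M {G ∘ suc} (λ k k<M → G≈0 (suc k) (s≤s k<M))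
  ... | inj₁ (ps≈0 , ps≈G) = inj₁ (ps≈0 , trans (paritySum-tail true (suc M) {G} (G≈0 0 (s≤s z≤n))) ps≈G)
  ... | inj₂ (ps≈G , ps≈0) = inj₂ (ps≈G , trans (paritySum-tail true (suc M) {G} (G≈0 0 (s≤s z≤n))) ps≈0)

  paritySum-endpoints : ∀ m (F : ℕ → ℕ) → 0 < m → (∀ k → 0 < k → k < m → F k ≈ 0) →
    paritySum true (suc m) F ≈ paritySum false (suc m) F → F 0 ≈ 0 ⇔ F m ≈ 0
  paritySum-endpoints (suc M) F _ middle≈0 balanced
    with paritySum-lastOnly false M {F ∘ suc} (λ k k<M → middle≈0 (suc k) (s≤s z≤n) (s≤s k<M))
  ... | inj₁ (odd≈0 , even≈last) = mk⇔ (λ F0≈0 → trans (sym F0≈last) F0≈0) (λ last≈0 → trans F0≈last last≈0)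
    where
    F0≈last : F 0 ≈ F (suc M)
    F0≈last = trans (cong (_% p) (sym (+-identityʳ (F 0))))
                    (trans (+-cong (refl {x = F 0 % p}) (sym odd≈0)) (trans balanced even≈last))
  ... | inj₂ (odd≈last , even≈0) =
    mk⇔ (+≈0⇒≈0 F0+last≈0) (+≈0⇒≈0 (trans (cong (_% p) (+-comm (F (suc M)) (F 0))) F0+last≈0))
    where
    F0+last≈0 : F 0 + F (suc M) ≈ 0
    F0+last≈0 = trans (+-cong (refl {x = F 0 % p}) (sym odd≈last)) (trans balanced even≈0)

-- Periodicity of vanishing along the layers


module _ {P : ℕ → Set} (m L N : ℕ)
         (up : ∀ {w} → L ≤ w → P w → P (w + m)) (down : ∀ {w} → w + m ≤ N → P (w + m) → P w) where

  iterate-up : ∀ k {w} → L ≤ w → P w → P (w + k * m)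
  iterate-up zero    {w} _   Pw = subst P (sym (+-identityʳ w)) Pw
  iterate-up (suc k) {w} L≤w Pw = subst P (+-assoc w m (k * m)) (iterate-up k (≤-trans L≤w (m≤m+n w m)) (up L≤w Pw))

  iterate-down : ∀ k {w} → w + k * m ≤ N → P (w + k * m) → P w
  iterate-down zero    {w} _       Pw = subst P (+-identityʳ w) Pw
  iterate-down (suc k) {w} w+km≤N Pw+km = down (≤-trans (m≤m+n (w + m) (k * m)) w+m+km≤N)
    (iterate-down k w+m+km≤N (subst P (sym (+-assoc w m (k * m))) Pw+km))
    where
    w+m+km≤N : w + m + k * m ≤ N
    w+m+km≤N = subst (_≤ N) (sym (+-assoc w m (k * m))) w+km≤N

  coset-closed : ∀ {j t} → L ≤ j → j ≤ N → ModEq m t j → P j → P t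
  coset-closed L≤j _   (k , inj₁ refl) Pj = iterate-up k L≤j Pj
  coset-closed _   j≤N (k , inj₂ refl) Pj = iterate-down k j≤N Pj

module Periodicity {p : ℕ} .{{_ : NonZero p}} (prime : Prime p) (n d ℓ : ℕ) (d≤n : d ≤ n) (d<p^ℓ : d < p ^ ℓ) where

  open Congruence p

  private
    m = p ^ ℓ

    a≡m+[d∸b] : ∀ {a b} → b ≤ d → a + b ≡ m + d → a ≡ m + (d ∸ b)
    a≡m+[d∸b] {a} {b} b≤d a+b≡m+d = +-cancelʳ-≡ b a (m + (d ∸ b))
      (trans a+b≡m+d (trans (cong (m +_) (sym (m∸n+n≡m b≤d))) (sym (+-assoc m (d ∸ b) b))))

  supersetCount[d]≈supersetCount[a+b] : ∀ {a b} → b ≤ d → a + b ≡ m + d →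
                                        supersetCount a b d ≈ supersetCount a b (a + b)
  supersetCount[d]≈supersetCount[a+b] {a} {b} b≤d a+b≡m+d = begin
    supersetCount a b d % p          ≡⟨ cong (_% p) (trans (supersetCount-≥ a b b≤d)
                                                            (cong (_C (d ∸ b)) (a≡m+[d∸b] b≤d a+b≡m+d))) ⟩
    ((m + (d ∸ b)) C (d ∸ b)) % p    ≡⟨ [p^ℓ+r]Ck≈rCk prime ℓ (d ∸ b) (≤-<-trans (m∸n≤m d b) d<p^ℓ) ⟩
    ((d ∸ b) C (d ∸ b)) % p          ≡⟨ cong (_% p) (trans (nCn≡1 (d ∸ b)) (sym (supersetCount-full a b))) ⟩
    supersetCount a b (b + a) % p    ≡⟨ cong (λ k → supersetCount a b k % p) (+-comm b a) ⟩
    supersetCount a b (a + b) % p    ∎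
    where open ≡-Reasoning

  supersetCount[m]≈supersetCount[0] : ∀ {a b} → b ≤ d → a + b ≡ m + d → supersetCount a b m ≈ supersetCount a b 0
  supersetCount[m]≈supersetCount[0] {a} {zero}  _   a+0≡m+d =
    trans (cong (λ a → (a C m) % p) (trans (sym (+-identityʳ a)) a+0≡m+d)) ([p^ℓ+r]C[p^ℓ]≈1 prime ℓ d<p^ℓ)
  supersetCount[m]≈supersetCount[0] {a} {suc b} b<d a+b≡m+d = begin
    supersetCount a (suc b) m % p    ≡⟨ cong (_% p) (trans (supersetCount-≥ a (suc b) 1+b≤m)
                                                            (cong (_C (m ∸ suc b)) (a≡m+[d∸b] b<d a+b≡m+d))) ⟩
    ((m + r) C (m ∸ suc b)) % p      ≡⟨ [p^ℓ+r]Ck≈rCk prime ℓ r (∸-monoʳ-< (s≤s z≤n) 1+b≤m) ⟩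
    (r C (m ∸ suc b)) % p            ≡⟨ cong (_% p) (k>n⇒nCk≡0 (∸-monoˡ-< d<p^ℓ b<d)) ⟩
    0 % p                            ∎
    where
    open ≡-Reasoning
    r = d ∸ suc b
    1+b≤m : suc b ≤ m
    1+b≤m = ≤-trans b<d (<⇒≤ d<p^ℓ)

  VanishesOnLayer : (Vec ℕ n → ℕ) → ℕ → Set
  VanishesOnLayer c w = ∀ x → weight x ≡ w → Vanishes p n d c x

  vanishing-up : ∀ c {w} → d ≤ w → VanishesOnLayer c w → VanishesOnLayer c (w + m)
  vanishing-up c {w} d≤w vanish z z≡w+m with split z {m + d} m+d≤z
    where m+d≤z = subst (m + d ≤_) (sym (trans z≡w+m (+-comm w m))) (+-monoʳ-≤ m d≤w)
  ... | y , A , y#A , A≡m+d , refl = ≈0⇒%≡0 (begin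
    evalP p n d c (y ∪ A) % p
      ≡⟨ cong (_% p) (∑-extensions-full y A (evalP p n d c)) ⟨
    (∑[ x ∈ extensions y A (weight A) ] evalP p n d c x) % p
      ≡⟨ ∑-evalP-extensions-≈ c y A y#A (λ a b a+b≡A b≤d →
           sym (trans (supersetCount[d]≈supersetCount[a+b] b≤d (trans a+b≡A A≡m+d))
                      (cong (λ k → supersetCount a b k % p) a+b≡A))) ⟩
    (∑[ x ∈ extensions y A d ] evalP p n d c x) % p
      ≡⟨ ∑-≈0 (extensions-weight y A d y#A) (λ x x≡y+d → %≡0⇒≈0 (vanish x (trans x≡y+d y+d≡w))) ⟩
    0 % p ∎)
    where
    open ≡-Reasoning
    y+d≡w : weight y + d ≡ w
    y+d≡w = +-cancelʳ-≡ m (weight y + d) w (begin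
      weight y + d + m     ≡⟨ +-assoc (weight y) d m ⟩
      weight y + (d + m)   ≡⟨ cong (weight y +_) (trans (+-comm d m) (sym A≡m+d)) ⟩
      weight y + weight A  ≡⟨ weight-∪ y A y#A ⟨
      weight (y ∪ A)       ≡⟨ z≡w+m ⟩
      w + m                ∎)

  vanishing-down : ∀ c {w} → w + m ≤ n ∸ d → VanishesOnLayer c (w + m) → VanishesOnLayer c w
  vanishing-down c {w} w+m≤n∸d vanish y y≡w with extend y {m + d} m+d+y≤n
    where m+d+y≤n = subst (_≤ n) (trans (+-assoc w m d) (trans (+-comm w (m + d)) (cong (m + d +_) (sym y≡w))))
                                 (m≤o∸n⇒m+n≤o (w + m) d≤n w+m≤n∸d)
  ... | B , y#B , B≡m+d = ≈0⇒%≡0 (begin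
    evalP p n d c y % p
      ≡⟨ cong (_% p) (∑-extensions-zero y B (evalP p n d c)) ⟨
    (∑[ x ∈ extensions y B 0 ] evalP p n d c x) % p
      ≡⟨ ∑-evalP-extensions-≈ c y B y#B (λ a b a+b≡B b≤d →
           sym (supersetCount[m]≈supersetCount[0] b≤d (trans a+b≡B B≡m+d))) ⟩
    (∑[ x ∈ extensions y B m ] evalP p n d c x) % p
      ≡⟨ ∑-≈0 (extensions-weight y B m y#B) (λ x x≡y+m → %≡0⇒≈0 (vanish x (trans x≡y+m (cong (_+ m) y≡w)))) ⟩
    0 % p ∎)
    where open ≡-Reasoning

  symmetric-step : ∀ {c} → Symmetric p n d c → ∀ (y B : Vec Bool n) → Disjoint y B → weight B ≡ m →
                   Vanishes p n d c y ⇔ Vanishes p n d c (y ∪ B)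
  symmetric-step {c} symmetric y B y#B B≡m =
    ⇔.trans (vanishes⇔ {0} {y} (∑-extensions-zero y B (evalP p n d c)))
   (⇔.trans (paritySum-endpoints (weight B) F (≤-<-trans z≤n d<B) middle≈0 (∑-evalP-extensions-alternating c y B y#B d<B))
            (⇔.sym (vanishes⇔ {weight B} {y ∪ B} (∑-extensions-full y B (evalP p n d c)))))
    where
    F : ℕ → ℕ
    F k = ∑[ x ∈ extensions y B k ] evalP p n d c x

    d<B : d < weight B
    d<B = subst (d <_) (sym B≡m) d<p^ℓ

    vanishes⇔ : ∀ {k x} → F k ≡ evalP p n d c x → Vanishes p n d c x ⇔ F k ≈ 0
    vanishes⇔ Fk≡x = mk⇔ (λ x≡0 → %≡0⇒≈0 (trans (cong (_% p) Fk≡x) x≡0))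
                         (λ Fk≈0 → ≈0⇒%≡0 (trans (cong (_% p) (sym Fk≡x)) Fk≈0))

    middle≈0 : ∀ k → 0 < k → k < weight B → F k ≈ 0
    middle≈0 k 0<k k<B = ∑-evalP-layer≈0 symmetric (extensions y B k) (extensions-weight y B k y#B)
      (subst (p ∣_) (sym (trans (length-extensions y B k) (cong (_C k) B≡m))) (p∣p^ℓCk prime ℓ 0<k (subst (k <_) B≡m k<B)))

  symmetric-vanishing-up : ∀ {c} → Symmetric p n d c → ∀ {w} → VanishesOnLayer c w → VanishesOnLayer c (w + m)
  symmetric-vanishing-up symmetric {w} vanish z z≡w+m with split z {m} (subst (m ≤_) (sym z≡w+m) (m≤n+m m w))
  ... | y , B , y#B , B≡m , refl = Equivalence.to (symmetric-step symmetric y B y#B B≡m) (vanish y y≡w)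
    where
    y≡w : weight y ≡ w
    y≡w = +-cancelʳ-≡ m (weight y) w (trans (cong (weight y +_) (sym B≡m)) (trans (sym (weight-∪ y B y#B)) z≡w+m))

  symmetric-vanishing-down : ∀ {c} → Symmetric p n d c → ∀ {w} → w + m ≤ n →
                             VanishesOnLayer c (w + m) → VanishesOnLayer c w
  symmetric-vanishing-down symmetric {w} w+m≤n vanish y y≡w
    with extend y {m} (subst (_≤ n) (trans (+-comm w m) (cong (m +_) (sym y≡w))) w+m≤n)
  ... | B , y#B , B≡m = Equivalence.from (symmetric-step symmetric y B y#B B≡m)
                                         (vanish (y ∪ B) (trans (weight-∪ y B y#B) (cong₂ _+_ y≡w B≡m)))

  VanishesOn : WSet → (Vec ℕ n → ℕ) → Set
  VanishesOn E c = ∀ x → Under E x → Vanishes p n d c x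

  VanishesOn⇒VanishesOnLayer : ∀ E c {j} → VanishesOn E c → E j → VanishesOnLayer c j
  VanishesOn⇒VanishesOnLayer E c vanish Ej x x≡j = vanish x (subst E (sym x≡j) Ej)

  VanishesOn-Shift : ∀ E c {j k} → VanishesOn E c → VanishesOnLayer c k → VanishesOn (Shift E j k) c
  VanishesOn-Shift E c vanish _       x (inj₁ Ex  , _) = vanish x Ex
  VanishesOn-Shift E c _      vanishk x (inj₂ x≡k , _) = vanishk x x≡k

  VanishesOn-unShift : ∀ E c {j k} → VanishesOn (Shift E j k) c → VanishesOnLayer c j → VanishesOn E c
  VanishesOn-unShift E c {j} vanish vanishj x Ex with weight x ≟ j
  ... | yes x≡j = vanishj x x≡j
  ... | no  x≢j = vanish x (inj₁ Ex , x≢j)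

  j+m∈Shift : ∀ E j → Shift E j (j + m) (j + m)
  j+m∈Shift E j = inj₂ refl , >⇒≢ (m<m+n j (m^n>0 p ℓ))

  Symcl-⊆ : ∀ {E F} → (∀ c → Symmetric p n d c → VanishesOn E c → VanishesOn F c) → Symcl p n d F ⊆ Symcl p n d E
  Symcl-⊆ E⇒F t (t≤n , t∈F) = t≤n , λ y y≡t c symmetric vanish → t∈F y y≡t c symmetric (E⇒F c symmetric vanish)

  Zcl-⊆ : ∀ {E F} → (∀ c → VanishesOn E c → VanishesOn F c) → Zcl p n d F ⊆ Zcl p n d E
  Zcl-⊆ E⇒F t (t≤n , t∈F) = t≤n , λ y y≡t c vanish → t∈F y y≡t c (E⇒F c vanish)

  Symcl-shift : ∀ E j → E j → j + m ≤ n → Symcl p n d E ≐ Symcl p n d (Shift E j (j + m))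
  Symcl-shift E j Ej j+m≤n t = mk⇔ (Symcl-⊆ {Shift E j (j + m)} {E} back t) (Symcl-⊆ {E} {Shift E j (j + m)} forth t)
    where
    forth : ∀ c → Symmetric p n d c → VanishesOn E c → VanishesOn (Shift E j (j + m)) c
    forth c symmetric vanish =
      VanishesOn-Shift E c vanish (symmetric-vanishing-up symmetric (VanishesOn⇒VanishesOnLayer E c vanish Ej))
    back : ∀ c → Symmetric p n d c → VanishesOn (Shift E j (j + m)) c → VanishesOn E c
    back c symmetric vanish =
      VanishesOn-unShift E c vanish
        (symmetric-vanishing-down symmetric j+m≤n (VanishesOn⇒VanishesOnLayer (Shift E j (j + m)) c vanish (j+m∈Shift E j)))

  Zcl-shift : ∀ E j → d ≤ j → E j → j + m ≤ n ∸ d → Zcl p n d E ≐ Zcl p n d (Shift E j (j + m))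
  Zcl-shift E j d≤j Ej j+m≤n∸d t = mk⇔ (Zcl-⊆ {Shift E j (j + m)} {E} back t) (Zcl-⊆ {E} {Shift E j (j + m)} forth t)
    where
    forth : ∀ c → VanishesOn E c → VanishesOn (Shift E j (j + m)) c
    forth c vanish = VanishesOn-Shift E c vanish (vanishing-up c d≤j (VanishesOn⇒VanishesOnLayer E c vanish Ej))
    back : ∀ c → VanishesOn (Shift E j (j + m)) c → VanishesOn E c
    back c vanish = VanishesOn-unShift E c vanish
      (vanishing-down c j+m≤n∸d (VanishesOn⇒VanishesOnLayer (Shift E j (j + m)) c vanish (j+m∈Shift E j)))

  j∈Coset : ∀ j → j ≤ n → Coset n m j j
  j∈Coset j j≤n = j≤n , 0 , inj₁ (sym (+-identityʳ j))

  Symcl-coset : ∀ E j → j ≤ n → Symcl p n d E j ⇔ (Coset n m j ⊆ Symcl p n d E)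
  Symcl-coset E j j≤n = mk⇔ (λ (_ , j∈cl) t (t≤n , t~j) → t≤n , λ y y≡t c symmetric vanish →
      coset-closed {VanishesOnLayer c} m 0 n (λ _ → symmetric-vanishing-up symmetric) (symmetric-vanishing-down symmetric)
                   z≤n j≤n t~j (λ x x≡j → j∈cl x x≡j c symmetric vanish) y y≡t)
    (λ Coset⊆cl → Coset⊆cl j (j∈Coset j j≤n))

  Zcl-coset : ∀ E j → d ≤ j → j ≤ n ∸ d → Zcl p n d E j ⇔ (Coset n m j ⊆ Zcl p n d E)
  Zcl-coset E j d≤j j≤n∸d = mk⇔ (λ (_ , j∈cl) t (t≤n , t~j) → t≤n , λ y y≡t c vanish →
      coset-closed {VanishesOnLayer c} m d (n ∸ d) (vanishing-up c) (vanishing-down c)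
                   d≤j j≤n∸d t~j (λ x x≡j → j∈cl x x≡j c vanish) y y≡t)
    (λ Coset⊆cl → Coset⊆cl j (j∈Coset j (≤-trans j≤n∸d (m∸n≤m n d))))

lemma4p10 : (p n d ℓ : ℕ) .{{_ : NonZero p}} → Prime p → 1 ≤ n → d ≤ n → IsCeilLog p d ℓ →
    ((E : WSet) (j : ℕ) → E ⊆ Interval 0 n → E j → j + p ^ ℓ ≤ n →
      Symcl p n d E ≐ Symcl p n d (Shift E j (j + p ^ ℓ)))
    × ((E : WSet) (j : ℕ) → E ⊆ Interval 0 n → j ≤ n →
      (Symcl p n d E j ⇔ (Coset n (p ^ ℓ) j ⊆ Symcl p n d E)))
    × ((E : WSet) (j : ℕ) → E ⊆ Interval d (n ∸ d) → E j → d ≤ j + p ^ ℓ → j + p ^ ℓ ≤ n ∸ d →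
      Zcl p n d E ≐ Zcl p n d (Shift E j (j + p ^ ℓ)))
    × ((E : WSet) (j : ℕ) → E ⊆ Interval d (n ∸ d) → d ≤ j → j ≤ n ∸ d →
      (Zcl p n d E j ⇔ (Coset n (p ^ ℓ) j ⊆ Zcl p n d E)))
lemma4p10 p n d ℓ p-prime _ d≤n (d<p^ℓ , _) =
    (λ E j _ Ej j+m≤n → Symcl-shift E j Ej j+m≤n)
  , (λ E j _ j≤n → Symcl-coset E j j≤n)
  , (λ E j E⊆[d,n-d] Ej _ j+m≤n∸d → Zcl-shift E j (proj₁ (E⊆[d,n-d] j Ej)) Ej j+m≤n∸d)
  , (λ E j _ d≤j j≤n∸d → Zcl-coset E j d≤j j≤n∸d)
  where open Periodicity p-prime n d ℓ d≤n d<p^ℓ
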